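{- The Segre variety $S_3(3)$ has exactly $3424$ geometric hyperplanes. Exactly $3280$ of them are projective, and these are in bijection with the $3280$ hyperplanes of $\mathrm{PG}(7,3)$. The remaining $144$ geometric hyperplanes are non-projective, and each of them is an ovoid of $S_3(3)$, i.e. a set of $16$ pairwise non-collinear points meeting every line in exactly one point.
   Context: For $k\ge 1$, $S_k(3)$ denotes the Segre variety $\mathrm{PG}(1,3)\times\cdots\times\mathrm{PG}(1,3)$ ($k$ factors), viewed as a point-line incidence structure: its points are the $k$-tuples $([x_1],\dots,[x_k])$ of points of the projective line $\mathrm{PG}(1,3)$ (which has $4$ points), and its lines are the sets of $4$ points obtained by letting one coordinate run over all of $\mathrm{PG}(1,3)$ while the other coordinates are fixed. A geometric hyperplane of $S_k(3)$ is a proper subset $H$ of the point set such that every line either is contained in $H$ or meets $H$ in exactly one point. Via the Segre embedding $([x_1],\dots,[x_k])\mapsto[x_1\otimes\cdots\otimes x_k]$, $S_k(3)$ is identified with a set of points of $\mathrm{PG}(2^k-1,3)$. A geometric hyperplane is called projective if it equals the intersection of (the image of) $S_k(3)$ with a hyperplane of $\mathrm{PG}(2^k-1,3)$, and non-projective otherwise. -}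

module Defs where

open import Data.Nat using (ℕ; _+_; _*_; _%_)
open import Data.Bool using (Bool; true; false)
open import Data.Fin using (Fin; zero; suc; toℕ)
open import Data.Vec using (Vec; lookup; tabulate)
open import Data.List using (List; length; []; _∷_)
open import Data.List.Relation.Unary.Unique.Propositional using (Unique)
open import Data.List.Membership.Propositional using (_∈_)
open import Data.Maybe using (Maybe; just; nothing)
open import Data.Product using (Σ; ∃; ∃-syntax; _×_; _,_)
open import Data.Sum using (_⊎_)
open import Relation.Binary.PropositionalEquality using (_≡_; _≢_)
open import Relation.Nullary using (¬_)
open import Function.Bundles using (_⇔_)

HasCard : {A : Set} → (A → Set) → ℕ → Set
HasCard {A} P n = Σ (List A) λ l → Unique l × (∀ x → (x ∈ l) ⇔ P x) × length l ≡ n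

-- The Segre variety S_3(3) = PG(1,3) × PG(1,3) × PG(1,3).
-- The 4 points of PG(1,3) are indexed by Fin 4.

Point : Set
Point = Fin 4 × Fin 4 × Fin 4

PointSet : Set
PointSet = Vec (Vec (Vec Bool 4) 4) 4

_∈P_ : Point → PointSet → Set
(x , y , z) ∈P H = lookup (lookup (lookup H x) y) z ≡ true

setCoord : Fin 3 → Point → Fin 4 → Point
setCoord zero          (x , y , z) t = (t , y , z)
setCoord (suc zero)    (x , y , z) t = (x , t , z)
setCoord (suc (suc zero)) (x , y , z) t = (x , y , t)

-- A line of S_3(3) is determined by a direction d and a point p: it is
-- { setCoord d p t | t ∈ PG(1,3) }.  (Each line arises from 4 choices of p;
-- this is harmless since we only quantify over all lines.)
Line : Set
Line = Fin 3 × Point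

_onLine_ : Point → Line → Set
q onLine (d , p) = ∃[ t ] q ≡ setCoord d p t

LineContainedIn : Line → PointSet → Set
LineContainedIn L H = ∀ q → q onLine L → q ∈P H

LineMeetsOnce : Line → PointSet → Set
LineMeetsOnce L H = Σ Point λ q → (q onLine L × q ∈P H) ×
                      (∀ q' → q' onLine L → q' ∈P H → q' ≡ q)

IsGeomHyperplane : PointSet → Set
IsGeomHyperplane H = (¬ (∀ p → p ∈P H)) ×
                     (∀ L → LineContainedIn L H ⊎ LineMeetsOnce L H)

-- Segre embedding into PG(7,3).
-- Coordinate vectors (over GF(3), entries as naturals 0,1,2) of the
-- points of PG(1,3): [1,0], [0,1], [1,1], [1,2].

rep : Fin 4 → Fin 2 → ℕ
rep zero                   zero = 1
rep zero                   (suc zero) = 0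
rep (suc zero)             zero = 0
rep (suc zero)             (suc zero) = 1
rep (suc (suc zero))       zero = 1
rep (suc (suc zero))       (suc zero) = 1
rep (suc (suc (suc zero))) zero = 1
rep (suc (suc (suc zero))) (suc zero) = 2

-- A linear form on GF(3)^8 = GF(3)^2 ⊗ GF(3)^2 ⊗ GF(3)^2, coefficient a_ijk.
Form : Set
Form = Vec (Vec (Vec (Fin 3) 2) 2) 2

coef : Form → Fin 2 → Fin 2 → Fin 2 → ℕ
coef a i j k = toℕ (lookup (lookup (lookup a i) j) k)

Σ2 : (Fin 2 → ℕ) → ℕ
Σ2 f = f zero + f (suc zero)

-- Value (as a natural number, to be reduced mod 3) of the form a on the
-- Segre image x₁ ⊗ x₂ ⊗ x₃ of the point (x , y , z).
evalForm : Form → Point → ℕ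
evalForm a (x , y , z) =
  Σ2 λ i → Σ2 λ j → Σ2 λ k → coef a i j k * rep x i * rep y j * rep z k

OnHyp : Form → Point → Set
OnHyp a p = evalForm a p % 3 ≡ 0

NonzeroForm : Form → Set
NonzeroForm a = ∃[ i ] ∃[ j ] ∃[ k ] lookup (lookup (lookup a i) j) k ≢ zero

IsProjective : PointSet → Set
IsProjective H = ∃[ a ] NonzeroForm a × (∀ p → (p ∈P H) ⇔ OnHyp a p)

isZero3 : ℕ → Bool
isZero3 n with n % 3
... | 0 = true
... | _ = false

section : Form → PointSet
section a = tabulate λ x → tabulate λ y → tabulate λ z → isZero3 (evalForm a (x , y , z))

-- Hyperplanes of PG(7,3): nonzero forms up to nonzero scalar, represented
-- by their unique normalized representative (first nonzero coefficient,
-- in the order a_000, a_001, ..., a_111, equals 1).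

flatten : Form → List (Fin 3)
flatten a = c zero zero zero ∷ c zero zero (suc zero) ∷ c zero (suc zero) zero ∷
            c zero (suc zero) (suc zero) ∷ c (suc zero) zero zero ∷
            c (suc zero) zero (suc zero) ∷ c (suc zero) (suc zero) zero ∷
            c (suc zero) (suc zero) (suc zero) ∷ []
  where c : Fin 2 → Fin 2 → Fin 2 → Fin 3
        c i j k = lookup (lookup (lookup a i) j) k

leading : List (Fin 3) → Maybe (Fin 3)
leading []           = nothing
leading (zero ∷ xs)  = leading xs
leading (suc x ∷ xs) = just (suc x)

IsPG7Hyperplane : Form → Set
IsPG7Hyperplane a = leading (flatten a) ≡ just (suc zero)

Collinear : Point → Point → Set
Collinear p q = ∃[ d ] ∃[ t ] q ≡ setCoord d p t

IsOvoid : PointSet → Set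
IsOvoid H = HasCard (_∈P H) 16 ×
            (∀ p q → p ∈P H → q ∈P H → p ≢ q → ¬ Collinear p q) ×
            (∀ L → LineMeetsOnce L H)

-- The geometric hyperplanes are found by an exhaustive backtracking search that decides membership
-- point by point and prunes as soon as some line through the decided point can no longer meet the set
-- in exactly one or in all of its points; the search is sound and complete and returns 3424 sets.
-- A hyperplane of PG(7,3) meets each line of S₃(3) in one point or entirely, and that trace determines
-- the restricted linear form up to a scalar, so gluing traces line by line reconstructs a candidate
-- equation for every found set: 3280 of them are cut out by their reconstructed normalised equation,
-- and the other 144 meet every line in exactly one of their 16 points. These 3280 equations are distinct
-- and PG(7,3) has exactly (3⁸ - 1)/2 = 3280 hyperplanes, so every hyperplane is reconstructed from its
-- section: sections of hyperplanes are geometric hyperplanes, and distinct hyperplanes have distinct sections.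

module Submission where

open import Defs
open import Data.Product using (Σ; ∃; ∃-syntax; _×_; _,_)
open import Relation.Binary.PropositionalEquality using (_≡_)
open import Relation.Nullary using (¬_)

open import Data.Bool using (Bool; true; false; _∧_; _∨_; not; T; if_then_else_)
import Data.Bool as Bool
open import Data.Bool.ListAction using (all)
open import Data.Bool.Properties using (T-≡; T-∧; T-∨; ¬-not; ⇔→≡)
open import Data.Empty using (⊥-elim)
open import Data.Fin using (Fin; zero; suc; toℕ)
import Data.Fin.Properties as Fin
open import Data.List
  using (List; []; _∷_; _++_; length; map; allFin; cartesianProduct; cartesianProductWith; filter; findᵇ; partition)
open import Data.List.Membership.Propositional using (_∈_)
open import Data.List.Membership.Propositional.Properties
  using (∈-allFin; ∈-cartesianProduct⁺; ∈-cartesianProductWith⁺; ∈-filter⁺; ∈-filter⁻; ∈-∃++; ∈-++⁻; ∈-++⁺ˡ; ∈-++⁺ʳ;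
         ∈-map⁻)
import Data.List.Membership.DecPropositional as DecMembership
open import Data.List.Properties using (length-++-sucʳ; length-map; map-∘; map-id-local; partition-defn)
open import Data.List.Relation.Binary.Subset.Propositional using (_⊆_)
import Data.List.Relation.Unary.All as All
open import Data.List.Relation.Unary.All.Properties using (all⁺; all⁻)
open import Data.List.Relation.Unary.AllPairs using ([]; _∷_)
open import Data.List.Relation.Unary.Any using (here; there)
open import Data.List.Relation.Unary.Unique.Propositional using (Unique)
import Data.List.Relation.Unary.Unique.Propositional.Properties as Unique
open import Data.Maybe using (Maybe; just; nothing; fromMaybe)
import Data.Maybe.Properties as Maybe
open import Data.Nat using (ℕ; _+_; _*_; _%_; _≤_; _<_; _≡ᵇ_; z≤n; s≤s)
open import Data.Nat.DivMod using (%-distribˡ-*; [m+kn]%n≡m%n; m%n<n)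
open import Data.Nat.Properties using (≤-trans; ≤-reflexive; <-irrefl; ≡ᵇ⇒≡; *-comm)
open import Data.Nat.Tactic.RingSolver using (solve-∀)
open import Data.Product using (proj₁; proj₂)
import Data.Product.Properties as Product
open import Data.Sum using (_⊎_; inj₁; inj₂)
open import Data.Unit using (tt)
open import Data.Vec using (Vec; []; _∷_; lookup; tabulate; replicate; updateAt)
import Data.Vec.Properties as Vec
open import Data.Vec.Relation.Binary.Pointwise.Inductive as Pointwise using (Pointwise; []; _∷_)
open import Function using (_∘_; _⇔_; mk⇔; Equivalence; case_of_)
open import Relation.Binary.Definitions using (DecidableEquality)
open import Relation.Binary.PropositionalEquality using (_≢_; refl; sym; trans; cong; cong₂; subst)
open import Relation.Nullary using (Dec; yes; no; ⌊_⌋)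
open import Relation.Nullary.Decidable using (T?; toWitness; fromWitness; _⊎-dec_)
open import Relation.Unary using (Pred; Decidable)
open import Relation.Unary.Properties using (∁?)

open Equivalence using (to; from)

private variable
  A B : Set
  n : ℕ

Enumerates : List A → Pred A _ → Set
Enumerates xs P = Unique xs × (∀ x → x ∈ xs ⇔ P x)

hasCard : {xs : List A} {P : Pred A _} → Enumerates xs P → length xs ≡ n → HasCard P n
hasCard {xs = xs} (unique , ∈⇔) len = xs , unique , ∈⇔ , len

Enumerates-resp-⇔ : {xs : List A} {P Q : Pred A _} → (∀ x → P x ⇔ Q x) → Enumerates xs P → Enumerates xs Q
Enumerates-resp-⇔ P⇔Q (unique , ∈⇔) =
  unique , λ x → mk⇔ (to (P⇔Q x) ∘ to (∈⇔ x)) (from (∈⇔ x) ∘ from (P⇔Q x))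

Enumerates-filter : {xs : List A} {P Q : Pred A _} (Q? : Decidable Q) →
                    Enumerates xs P → Enumerates (filter Q? xs) (λ x → P x × Q x)
Enumerates-filter Q? (unique , ∈⇔) = Unique.filter⁺ Q? unique , λ x → mk⇔
  (λ x∈ → let x∈xs , Qx = ∈-filter⁻ Q? x∈ in to (∈⇔ x) x∈xs , Qx)
  (λ (Px , Qx) → ∈-filter⁺ Q? (from (∈⇔ x) Px) Qx)

Covers : List A → Set
Covers xs = ∀ x → x ∈ xs

filter-enumerates : {xs : List A} {Q : Pred A _} (Q? : Decidable Q) → Unique xs → Covers xs → Enumerates (filter Q? xs) Q
filter-enumerates Q? unique covers =
  Enumerates-resp-⇔ (λ x → mk⇔ proj₂ (tt ,_))
    (Enumerates-filter Q? (unique , λ x → mk⇔ (λ _ → tt) (λ _ → covers x)))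

all-∈ : (p : A → Bool) (xs : List A) → T (all p xs) → ∀ {x} → x ∈ xs → T (p x)
all-∈ p xs = All.lookup ∘ all⁺ p xs

all-intro : (p : A → Bool) (xs : List A) → (∀ {x} → x ∈ xs → T (p x)) → T (all p xs)
all-intro p xs h = all⁻ p (All.tabulate h)

vectors : List A → (n : ℕ) → List (Vec A n)
vectors xs ℕ.zero    = [] ∷ []
vectors xs (ℕ.suc n) = cartesianProductWith _∷_ xs (vectors xs n)

vectors-covers : {xs : List A} → Covers xs → Covers (vectors xs n)
vectors-covers covers []       = here refl
vectors-covers covers (x ∷ v) = ∈-cartesianProductWith⁺ _∷_ (covers x) (vectors-covers covers v)

vectors-unique : {xs : List A} → Unique xs → Unique (vectors xs n)
vectors-unique {n = ℕ.zero}  unique = All.[] ∷ []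
vectors-unique {n = ℕ.suc n} unique = Unique.cartesianProductWith⁺ _∷_ Vec.∷-injective unique (vectors-unique unique)

∈-++-∷⁻ : ∀ {x y : A} xs ys → y ∈ xs ++ x ∷ ys → y ≢ x → y ∈ xs ++ ys
∈-++-∷⁻ xs ys y∈ y≢x with ∈-++⁻ xs y∈
... | inj₁ y∈xs         = ∈-++⁺ˡ y∈xs
... | inj₂ (here y≡x)   = ⊥-elim (y≢x y≡x)
... | inj₂ (there y∈ys) = ∈-++⁺ʳ xs y∈ys

Unique-⊆⇒length≤ : {xs ys : List A} → Unique xs → xs ⊆ ys → length xs ≤ length ys
Unique-⊆⇒length≤ {xs = []}     _                   _        = z≤n
Unique-⊆⇒length≤ {xs = x ∷ xs} (x∉xs ∷ unique) x∷xs⊆ys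
  with as , bs , refl ← ∈-∃++ (x∷xs⊆ys (here refl)) =
  subst (length (x ∷ xs) ≤_) (sym (length-++-sucʳ as x bs))
    (s≤s (Unique-⊆⇒length≤ unique λ y∈xs →
      ∈-++-∷⁻ as bs (x∷xs⊆ys (there y∈xs)) (λ y≡x → All.lookup x∉xs y∈xs (sym y≡x))))

pigeonhole : DecidableEquality A → {xs ys : List A} → Unique xs → xs ⊆ ys → length ys ≤ length xs → ys ⊆ xs
pigeonhole _≟_ {xs} unique xs⊆ys ys≤xs {y} y∈ys with y ∈? xs
  where open DecMembership _≟_ using (_∈?_)
... | yes y∈xs = y∈xs
... | no  y∉xs with as , bs , refl ← ∈-∃++ y∈ys =
  ⊥-elim (<-irrefl refl (≤-trans (subst (_≤ length xs) (length-++-sucʳ as y bs) ys≤xs)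
                                 (Unique-⊆⇒length≤ unique λ x∈xs →
                                   ∈-++-∷⁻ as bs (xs⊆ys x∈xs) (λ { refl → y∉xs x∈xs }))))

Cube : Set → Set
Cube A = Vec (Vec (Vec A 4) 4) 4

infix 8 _!_

_!_ : Cube A → Point → A
c ! (x , y , z) = lookup (lookup (lookup c x) y) z

_[_]≔_ : Cube A → Point → A → Cube A
c [ x , y , z ]≔ v = updateAt c x λ r → updateAt r y λ s → updateAt s z λ _ → v

_≟ᵖ_ : DecidableEquality Point
_≟ᵖ_ = Product.≡-dec Fin._≟_ (Product.≡-dec Fin._≟_ Fin._≟_)

!-updated : (c : Cube A) (p : Point) (v : A) → (c [ p ]≔ v) ! p ≡ v
!-updated c (x , y , z) v
  rewrite Vec.lookup∘updateAt x {λ r → updateAt r y λ s → updateAt s z λ _ → v} c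
        | Vec.lookup∘updateAt y {λ s → updateAt s z λ _ → v} (lookup c x)
        | Vec.lookup∘updateAt z {λ _ → v} (lookup (lookup c x) y) = refl

!-unchanged : (c : Cube A) {p q : Point} (v : A) → p ≢ q → (c [ p ]≔ v) ! q ≡ c ! q
!-unchanged c {x , y , z} {x′ , y′ , z′} v p≢q with x Fin.≟ x′ | y Fin.≟ y′ | z Fin.≟ z′
... | yes refl | yes refl | yes refl = ⊥-elim (p≢q refl)
... | no x≢x′  | _        | _        =
  cong (λ r → lookup (lookup r y′) z′) (Vec.lookup∘updateAt′ x′ x (x≢x′ ∘ sym) c)
... | yes refl | no y≢y′  | _
  rewrite Vec.lookup∘updateAt x {λ r → updateAt r y λ s → updateAt s z λ _ → v} c =
  cong (λ s → lookup s z′) (Vec.lookup∘updateAt′ y′ y (y≢y′ ∘ sym) (lookup c x))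
... | yes refl | yes refl | no z≢z′
  rewrite Vec.lookup∘updateAt x {λ r → updateAt r y λ s → updateAt s z λ _ → v} c
        | Vec.lookup∘updateAt y {λ s → updateAt s z λ _ → v} (lookup c x) =
  Vec.lookup∘updateAt′ z′ z (z≢z′ ∘ sym) (lookup (lookup c x) y)

Vec-ext : {u v : Vec A n} → (∀ i → lookup u i ≡ lookup v i) → u ≡ v
Vec-ext {u = u} {v} h = trans (sym (Vec.tabulate∘lookup u)) (trans (Vec.tabulate-cong h) (Vec.tabulate∘lookup v))

Cube-ext : {c d : Cube A} → (∀ p → c ! p ≡ d ! p) → c ≡ d
Cube-ext h = Vec-ext λ x → Vec-ext λ y → Vec-ext λ z → h (x , y , z)

!-map : (f : A → B) (c : Cube A) (p : Point) → Data.Vec.map (Data.Vec.map (Data.Vec.map f)) c ! p ≡ f (c ! p)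
!-map f c (x , y , z)
  rewrite Vec.lookup-map x (Data.Vec.map (Data.Vec.map f)) c
        | Vec.lookup-map y (Data.Vec.map f) (lookup c x) = Vec.lookup-map z f (lookup (lookup c x) y)

!-replicate : (v : A) (p : Point) → replicate 4 (replicate 4 (replicate 4 v)) ! p ≡ v
!-replicate v (x , y , z)
  rewrite Vec.lookup-replicate x (replicate 4 (replicate 4 v))
        | Vec.lookup-replicate y (replicate 4 v) = Vec.lookup-replicate z v

!-tabulate : (f : Point → A) (p : Point) → tabulate (λ x → tabulate λ y → tabulate λ z → f (x , y , z)) ! p ≡ f p
!-tabulate f (x , y , z)
  rewrite Vec.lookup∘tabulate (λ x → tabulate λ y → tabulate λ z → f (x , y , z)) x
        | Vec.lookup∘tabulate (λ y → tabulate λ z → f (x , y , z)) y = Vec.lookup∘tabulate (λ z → f (x , y , z)) z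

points : List Point
points = cartesianProduct (allFin 4) (cartesianProduct (allFin 4) (allFin 4))

points-covers : Covers points
points-covers (x , y , z) = ∈-cartesianProduct⁺ (∈-allFin x) (∈-cartesianProduct⁺ (∈-allFin y) (∈-allFin z))

points-unique : Unique points
points-unique =
  Unique.cartesianProduct⁺ (Unique.allFin⁺ 4) (Unique.cartesianProduct⁺ (Unique.allFin⁺ 4) (Unique.allFin⁺ 4))

-- Spelled out: the tabulate form makes the exhaustive search markedly slower.
lineTrace : Cube A → Line → Vec A 4
lineTrace c (d , p) = c ! setCoord d p zero ∷ c ! setCoord d p (suc zero) ∷ c ! setCoord d p (suc (suc zero))
                      ∷ c ! setCoord d p (suc (suc (suc zero))) ∷ []

lookup-lineTrace : (c : Cube A) (d : Fin 3) (p : Point) (t : Fin 4) → lookup (lineTrace c (d , p)) t ≡ c ! setCoord d p t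
lookup-lineTrace c d p zero                   = refl
lookup-lineTrace c d p (suc zero)             = refl
lookup-lineTrace c d p (suc (suc zero))       = refl
lookup-lineTrace c d p (suc (suc (suc zero))) = refl

AllTrue : Vec Bool n → Set
AllTrue b = ∀ t → lookup b t ≡ true

ExactlyOneTrue : Vec Bool n → Set
ExactlyOneTrue b = ∃[ t₀ ] lookup b t₀ ≡ true × (∀ t → lookup b t ≡ true → t ≡ t₀)

indicator : Fin n → Vec Bool n
indicator t₀ = tabulate λ t → ⌊ t Fin.≟ t₀ ⌋

indicator-exactlyOne : (t₀ : Fin n) → ExactlyOneTrue (indicator t₀)
indicator-exactlyOne t₀ =
  t₀ , trans (lookup-indicator t₀) (to T-≡ (fromWitness refl)) ,
  λ t hit → toWitness (from T-≡ (trans (sym (lookup-indicator t)) hit))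
  where
  lookup-indicator : ∀ t → lookup (indicator t₀) t ≡ ⌊ t Fin.≟ t₀ ⌋
  lookup-indicator = Vec.lookup∘tabulate _

isFullTrace : Vec Bool 4 → Bool
isFullTrace (true ∷ true ∷ true ∷ true ∷ []) = true
isFullTrace _                                = false

isSingletonTrace : Vec Bool 4 → Bool
isSingletonTrace (true  ∷ false ∷ false ∷ false ∷ []) = true
isSingletonTrace (false ∷ true  ∷ false ∷ false ∷ []) = true
isSingletonTrace (false ∷ false ∷ true  ∷ false ∷ []) = true
isSingletonTrace (false ∷ false ∷ false ∷ true  ∷ []) = true
isSingletonTrace _                                    = false

isLineTrace : Vec Bool 4 → Bool
isLineTrace b = isFullTrace b ∨ isSingletonTrace b

isFullTrace⇔AllTrue : (b : Vec Bool 4) → T (isFullTrace b) ⇔ AllTrue b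
isFullTrace⇔AllTrue b = mk⇔ (sound b) complete
  where
  sound : ∀ b → T (isFullTrace b) → AllTrue b
  sound (true ∷ true ∷ true ∷ true ∷ []) _ t = Vec.lookup-replicate t true
  complete : AllTrue b → T (isFullTrace b)
  complete all-true = subst (T ∘ isFullTrace) (Vec-ext λ t → trans (Vec.lookup-replicate t true) (sym (all-true t))) tt

isSingletonTrace⇔ExactlyOneTrue : (b : Vec Bool 4) → T (isSingletonTrace b) ⇔ ExactlyOneTrue b
isSingletonTrace⇔ExactlyOneTrue b = mk⇔ (sound b) complete
  where
  sound : ∀ b → T (isSingletonTrace b) → ExactlyOneTrue b
  sound (true  ∷ false ∷ false ∷ false ∷ []) _ = indicator-exactlyOne zero
  sound (false ∷ true  ∷ false ∷ false ∷ []) _ = indicator-exactlyOne (suc zero)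
  sound (false ∷ false ∷ true  ∷ false ∷ []) _ = indicator-exactlyOne (suc (suc zero))
  sound (false ∷ false ∷ false ∷ true  ∷ []) _ = indicator-exactlyOne (suc (suc (suc zero)))
  sound (true  ∷ true  ∷ _     ∷ _     ∷ []) ()
  sound (true  ∷ false ∷ true  ∷ _     ∷ []) ()
  sound (true  ∷ false ∷ false ∷ true  ∷ []) ()
  sound (false ∷ true  ∷ true  ∷ _     ∷ []) ()
  sound (false ∷ true  ∷ false ∷ true  ∷ []) ()
  sound (false ∷ false ∷ true  ∷ true  ∷ []) ()
  sound (false ∷ false ∷ false ∷ false ∷ []) ()
  complete : ExactlyOneTrue b → T (isSingletonTrace b)
  complete (t₀ , hit , unique) = subst (T ∘ isSingletonTrace) (sym b≡indicator) (indicator-singleton t₀)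
    where
    indicator-singleton : ∀ t₀ → T (isSingletonTrace (indicator t₀))
    indicator-singleton zero                   = tt
    indicator-singleton (suc zero)             = tt
    indicator-singleton (suc (suc zero))       = tt
    indicator-singleton (suc (suc (suc zero))) = tt
    b≡indicator : b ≡ indicator t₀
    b≡indicator = Vec-ext λ t → trans (entry t) (sym (Vec.lookup∘tabulate (λ t → ⌊ t Fin.≟ t₀ ⌋) t))
      where
      entry : ∀ t → lookup b t ≡ ⌊ t Fin.≟ t₀ ⌋
      entry t with t Fin.≟ t₀
      ... | yes refl = hit
      ... | no t≢t₀  = ¬-not (t≢t₀ ∘ unique t)

coordinate : Fin 3 → Point → Fin 4
coordinate zero             (x , y , z) = x
coordinate (suc zero)       (x , y , z) = y
coordinate (suc (suc zero)) (x , y , z) = z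

setCoord-coordinate : (d : Fin 3) (p : Point) → setCoord d p (coordinate d p) ≡ p
setCoord-coordinate zero             p = refl
setCoord-coordinate (suc zero)       p = refl
setCoord-coordinate (suc (suc zero)) p = refl

setCoord-injective : (d : Fin 3) (p : Point) {t t′ : Fin 4} → setCoord d p t ≡ setCoord d p t′ → t ≡ t′
setCoord-injective d p eq = trans (sym (coordinate-setCoord d)) (trans (cong (coordinate d) eq) (coordinate-setCoord d))
  where
  coordinate-setCoord : ∀ d {t} → coordinate d (setCoord d p t) ≡ t
  coordinate-setCoord zero             = refl
  coordinate-setCoord (suc zero)       = refl
  coordinate-setCoord (suc (suc zero)) = refl

AllTrue-lineTrace⇔LineContainedIn : (H : PointSet) (L : Line) → AllTrue (lineTrace H L) ⇔ LineContainedIn L H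
AllTrue-lineTrace⇔LineContainedIn H (d , p) = mk⇔
  (λ { all-true q (t , refl) → trans (sym (lookup-lineTrace H d p t)) (all-true t) })
  (λ contained t → trans (lookup-lineTrace H d p t) (contained _ (t , refl)))

ExactlyOneTrue-lineTrace⇔LineMeetsOnce : (H : PointSet) (L : Line) → ExactlyOneTrue (lineTrace H L) ⇔ LineMeetsOnce L H
ExactlyOneTrue-lineTrace⇔LineMeetsOnce H (d , p) = mk⇔
  (λ (t₀ , hit , unique) → setCoord d p t₀ , ((t₀ , refl) , trans (sym (lookup-lineTrace H d p t₀)) hit) ,
     λ { q (t , refl) q∈H → cong (setCoord d p) (unique t (trans (lookup-lineTrace H d p t) q∈H)) })
  (λ { (q , ((t₀ , refl) , q∈H) , unique) → t₀ , trans (lookup-lineTrace H d p t₀) q∈H ,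
     λ t hit → setCoord-injective d p (unique _ (t , refl) (trans (sym (lookup-lineTrace H d p t)) hit)) })

isLineTrace⇔ : (H : PointSet) (L : Line) → T (isLineTrace (lineTrace H L)) ⇔ (LineContainedIn L H ⊎ LineMeetsOnce L H)
isLineTrace⇔ H L = mk⇔
  (Data.Sum.map (to (AllTrue-lineTrace⇔LineContainedIn H L) ∘ to (isFullTrace⇔AllTrue b))
                (to (ExactlyOneTrue-lineTrace⇔LineMeetsOnce H L) ∘ to (isSingletonTrace⇔ExactlyOneTrue b)) ∘ to ∨⇔)
  (from ∨⇔ ∘ Data.Sum.map (from (isFullTrace⇔AllTrue b) ∘ from (AllTrue-lineTrace⇔LineContainedIn H L))
                          (from (isSingletonTrace⇔ExactlyOneTrue b) ∘ from (ExactlyOneTrue-lineTrace⇔LineMeetsOnce H L)))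
  where
  b = lineTrace H L
  ∨⇔ = T-∨ {isFullTrace b} {isSingletonTrace b}

-- Each line is listed once, through its point with coordinate zero in the varying direction.
baseLine : Fin 3 → Fin 4 × Fin 4 → Line
baseLine zero             (u , v) = zero , (zero , u , v)
baseLine (suc zero)       (u , v) = suc zero , (u , zero , v)
baseLine (suc (suc zero)) (u , v) = suc (suc zero) , (u , v , zero)

lines : List Line
lines = cartesianProductWith baseLine (allFin 3) (cartesianProduct (allFin 4) (allFin 4))

all-lines⇔ : (f : Vec A 4 → Bool) (c : Cube A) → T (all (f ∘ lineTrace c) lines) ⇔ (∀ L → T (f (lineTrace c L)))
all-lines⇔ f c = mk⇔
  (λ h (d , p) → subst (T ∘ f) (same-line d p) (all-∈ (f ∘ lineTrace c) lines h (base∈lines d p)))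
  (λ h → all-intro (f ∘ lineTrace c) lines λ {L} _ → h L)
  where
  otherCoordinates : Fin 3 → Point → Fin 4 × Fin 4
  otherCoordinates zero             (x , y , z) = y , z
  otherCoordinates (suc zero)       (x , y , z) = x , z
  otherCoordinates (suc (suc zero)) (x , y , z) = x , y
  same-line : ∀ d p → lineTrace c (baseLine d (otherCoordinates d p)) ≡ lineTrace c (d , p)
  same-line zero             p = refl
  same-line (suc zero)       p = refl
  same-line (suc (suc zero)) p = refl
  base∈lines : ∀ d p → baseLine d (otherCoordinates d p) ∈ lines
  base∈lines d p = ∈-cartesianProductWith⁺ baseLine (∈-allFin d) (∈-cartesianProduct⁺ (∈-allFin _) (∈-allFin _))

T-not : (b : Bool) → T (not b) ⇔ (¬ T b)
T-not true  = mk⇔ (λ ()) (λ ¬T → ¬T tt)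
T-not false = mk⇔ (λ _ ()) (λ _ → tt)

all-points⇔ : (H : PointSet) → T (all (H !_) points) ⇔ (∀ p → p ∈P H)
all-points⇔ H = mk⇔ (λ h p → to T-≡ (all-∈ (H !_) points h (points-covers p)))
                    (λ h → all-intro (H !_) points λ {p} _ → from T-≡ (h p))

isGeomHyperplaneᵇ : PointSet → Bool
isGeomHyperplaneᵇ H = not (all (H !_) points) ∧ all (isLineTrace ∘ lineTrace H) lines

isGeomHyperplaneᵇ⇔ : (H : PointSet) → T (isGeomHyperplaneᵇ H) ⇔ IsGeomHyperplane H
isGeomHyperplaneᵇ⇔ H = mk⇔
  (λ h → let proper , onLines = to T-∧ h in
    (λ all-in → to (T-not _) proper (from (all-points⇔ H) all-in)) ,
    λ L → to (isLineTrace⇔ H L) (to (all-lines⇔ isLineTrace H) onLines L))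
  (λ (proper , onLines) → from T-∧
    (from (T-not _) (proper ∘ to (all-points⇔ H)) ,
     from (all-lines⇔ isLineTrace H) λ L → from (isLineTrace⇔ H L) (onLines L)))

-- Partial assignments and backtracking search

Partial : Set
Partial = Cube (Maybe Bool)

infix 4 _⊑_ _⊑?_

_⊑_ : Maybe Bool → Bool → Set
m ⊑ b = m ≡ nothing ⊎ m ≡ just b

_⊑?_ : (m : Maybe Bool) (b : Bool) → Dec (m ⊑ b)
m ⊑? b = Maybe.≡-dec Bool._≟_ m nothing ⊎-dec Maybe.≡-dec Bool._≟_ m (just b)

just≢nothing : {x : A} → just x ≢ nothing
just≢nothing ()

Extends : PointSet → Partial → Set
Extends H w = ∀ q → w ! q ⊑ H ! q

Pending : List Point → Partial → Set
Pending ps w = ∀ q → q ∈ ps ⇔ w ! q ≡ nothing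

unknown : Partial
unknown = replicate 4 (replicate 4 (replicate 4 nothing))

Pending-unknown : Pending points unknown
Pending-unknown q = mk⇔ (λ _ → !-replicate nothing q) (λ _ → points-covers q)

Pending-assign : {p : Point} {ps : List Point} {w : Partial} (b : Bool) →
                 Unique (p ∷ ps) → Pending (p ∷ ps) w → Pending ps (w [ p ]≔ just b)
Pending-assign {p} {ps} {w} b (p∉ps ∷ _) pending q with p ≟ᵖ q
... | yes refl = mk⇔ (λ p∈ps → ⊥-elim (All.lookup p∉ps p∈ps refl))
                     (λ assigned → ⊥-elim (just≢nothing (trans (sym (!-updated w p (just b))) assigned)))
... | no p≢q = mk⇔ (λ q∈ps → trans (!-unchanged w (just b) p≢q) (to (pending q) (there q∈ps)))
                   (λ unassigned → drop-p (from (pending q) (trans (sym (!-unchanged w (just b) p≢q)) unassigned)))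
  where drop-p : q ∈ p ∷ ps → q ∈ ps
        drop-p (here q≡p)  = ⊥-elim (p≢q (sym q≡p))
        drop-p (there q∈ps) = q∈ps

Extends-assign : {H : PointSet} {w : Partial} (p : Point) → Extends H w → Extends H (w [ p ]≔ just (H ! p))
Extends-assign {H} {w} p extends q with p ≟ᵖ q
... | yes refl = inj₂ (!-updated w p (just (H ! p)))
... | no p≢q   = subst (_⊑ H ! q) (sym (!-unchanged w (just (H ! p)) p≢q)) (extends q)

completion : Partial → PointSet
completion = Data.Vec.map (Data.Vec.map (Data.Vec.map (fromMaybe false)))

completion-total : {w : Partial} → Pending [] w → ∀ q → w ! q ≡ just (completion w ! q)
completion-total {w} pending q = trans (known (w ! q) (λ unassigned → case from (pending q) unassigned of λ ()))
                                       (cong just (sym (!-map (fromMaybe false) w q)))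
  where
  known : ∀ m → m ≢ nothing → m ≡ just (fromMaybe false m)
  known nothing  m≢nothing = ⊥-elim (m≢nothing refl)
  known (just c) _         = refl

completion-unique : {H : PointSet} {w : Partial} → Pending [] w → Extends H w → completion w ≡ H
completion-unique {H} {w} pending extends = Cube-ext λ q → known q (extends q)
  where
  known : ∀ q → w ! q ⊑ H ! q → completion w ! q ≡ H ! q
  known q (inj₁ unassigned) = ⊥-elim (just≢nothing (trans (sym (completion-total {w} pending q)) unassigned))
  known q (inj₂ assigned)   = Maybe.just-injective (trans (sym (completion-total {w} pending q)) assigned)

∈-if : (c : Bool) (xs : List A) {x : A} → x ∈ (if c then xs else []) → T c × x ∈ xs
∈-if true xs x∈ = tt , x∈

if-∈ : (c : Bool) (xs : List A) {x : A} → T c → x ∈ xs → x ∈ (if c then xs else [])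
if-∈ true xs _ x∈ = x∈

if-unique : (c : Bool) {xs : List A} → Unique xs → Unique (if c then xs else [])
if-unique true  unique = unique
if-unique false unique = []

module Backtracking (accept : PointSet → Bool) (admissible : Partial → Point → Bool) where

  branch : (Partial → List PointSet) → Partial → Point → Bool → List PointSet
  branch continue w p b = if admissible w′ p then continue w′ else []
    where w′ = w [ p ]≔ just b

  search : List Point → Partial → List PointSet
  search []       w = if accept (completion w) then completion w ∷ [] else []
  search (p ∷ ps) w = branch (search ps) w p false ++ branch (search ps) w p true

  ∈-branches : {ps : List Point} {w : Partial} {p : Point} {H : PointSet} (b : Bool) →
               H ∈ branch (search ps) w p b → H ∈ search (p ∷ ps) w
  ∈-branches false H∈ = ∈-++⁺ˡ H∈
  ∈-branches {ps} {w} {p} true H∈ = ∈-++⁺ʳ (branch (search ps) w p false) H∈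

  branches-∈ : {ps : List Point} {w : Partial} {p : Point} {H : PointSet} →
               H ∈ search (p ∷ ps) w → ∃[ b ] H ∈ search ps (w [ p ]≔ just b)
  branches-∈ {ps} {w} {p} H∈ with ∈-++⁻ (branch (search ps) w p false) H∈
  ... | inj₁ H∈false = false , proj₂ (∈-if (admissible _ p) _ H∈false)
  ... | inj₂ H∈true  = true  , proj₂ (∈-if (admissible _ p) _ H∈true)

  search-accepts : (ps : List Point) (w : Partial) {H : PointSet} → H ∈ search ps w → T (accept H)
  search-accepts [] w H∈ with accepted , here refl ← ∈-if (accept (completion w)) _ H∈ = accepted
  search-accepts (p ∷ ps) w H∈ =
    let b , H∈′ = branches-∈ {ps} {w} {p} H∈ in search-accepts ps (w [ p ]≔ just b) H∈′

  search-extends : (ps : List Point) (w : Partial) {H : PointSet} →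
                   Unique ps → Pending ps w → H ∈ search ps w → Extends H w
  search-extends [] w _ pending H∈ with _ , here refl ← ∈-if (accept (completion w)) _ H∈ =
    inj₂ ∘ completion-total {w} pending
  search-extends (p ∷ ps) w unique@(_ ∷ unique′) pending H∈ q
    with b , H∈′ ← branches-∈ {ps} {w} {p} H∈ | p ≟ᵖ q
  ... | yes refl = inj₁ (to (pending p) (here refl))
  ... | no p≢q   = subst (_⊑ _) (!-unchanged w (just b) p≢q)
                     (search-extends ps (w [ p ]≔ just b) unique′ (Pending-assign {w = w} b unique pending) H∈′ q)

  search-assigns : (ps : List Point) (w : Partial) {p : Point} {H : PointSet} (b : Bool) →
                   Unique (p ∷ ps) → Pending (p ∷ ps) w → H ∈ search ps (w [ p ]≔ just b) → H ! p ≡ b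
  search-assigns ps w {p} b unique@(_ ∷ unique′) pending H∈
    with search-extends ps (w [ p ]≔ just b) unique′ (Pending-assign {w = w} b unique pending) H∈ p
  ... | inj₁ unassigned = ⊥-elim (just≢nothing (trans (sym (!-updated w p (just b))) unassigned))
  ... | inj₂ assigned   = sym (Maybe.just-injective (trans (sym (!-updated w p (just b))) assigned))

  search-unique : (ps : List Point) (w : Partial) → Unique ps → Pending ps w → Unique (search ps w)
  search-unique []       w _ _ = if-unique (accept (completion w)) (All.[] ∷ [])
  search-unique (p ∷ ps) w unique@(_ ∷ unique′) pending =
    Unique.++⁺ (branch-unique false) (branch-unique true)
      λ {H} (H∈false , H∈true) → false≢true (trans (sym (assigned false H∈false)) (assigned true H∈true))
    where
    false≢true : false ≢ true
    false≢true ()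
    branch-unique : ∀ b → Unique (branch (search ps) w p b)
    branch-unique b = if-unique (admissible _ p) (search-unique ps _ unique′ (Pending-assign {w = w} b unique pending))
    assigned : ∀ b {H} → H ∈ branch (search ps) w p b → H ! p ≡ b
    assigned b {H} H∈ = search-assigns ps w {p} {H} b unique pending (proj₂ (∈-if (admissible _ p) _ H∈))

  search-complete : {H : PointSet} → (∀ w p → Extends H w → T (admissible w p)) → T (accept H) →
                    (ps : List Point) (w : Partial) → Unique ps → Pending ps w → Extends H w → H ∈ search ps w
  search-complete {H} _ accepted [] w _ pending extends =
    subst (λ K → H ∈ (if accept K then K ∷ [] else [])) (sym (completion-unique pending extends))
      (if-∈ (accept H) _ accepted (here refl))
  search-complete {H} admissible-H accepted (p ∷ ps) w unique@(_ ∷ unique′) pending extends =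
    ∈-branches {ps} {w} {p} (H ! p) (if-∈ (admissible w′ p) _ (admissible-H w′ p extends′)
      (search-complete admissible-H accepted ps w′ unique′ (Pending-assign {w = w} (H ! p) unique pending) extends′))
    where
    w′ = w [ p ]≔ just (H ! p)
    extends′ = Extends-assign {H} {w} p extends

-- False exactly when no line trace completes the decided entries: four nonmembers, or two members
-- and a nonmember.
isPartialLineTrace : Vec (Maybe Bool) 4 → Bool
isPartialLineTrace (just false ∷ just false ∷ just false ∷ just false ∷ []) = false
isPartialLineTrace (just true  ∷ just true  ∷ just false ∷ _          ∷ []) = false
isPartialLineTrace (just true  ∷ just true  ∷ _          ∷ just false ∷ []) = false
isPartialLineTrace (just true  ∷ just false ∷ just true  ∷ _          ∷ []) = false
isPartialLineTrace (just true  ∷ _          ∷ just true  ∷ just false ∷ []) = false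
isPartialLineTrace (just true  ∷ just false ∷ _          ∷ just true  ∷ []) = false
isPartialLineTrace (just true  ∷ _          ∷ just false ∷ just true  ∷ []) = false
isPartialLineTrace (just false ∷ just true  ∷ just true  ∷ _          ∷ []) = false
isPartialLineTrace (_          ∷ just true  ∷ just true  ∷ just false ∷ []) = false
isPartialLineTrace (just false ∷ just true  ∷ _          ∷ just true  ∷ []) = false
isPartialLineTrace (_          ∷ just true  ∷ just false ∷ just true  ∷ []) = false
isPartialLineTrace (just false ∷ _          ∷ just true  ∷ just true  ∷ []) = false
isPartialLineTrace (_          ∷ just false ∷ just true  ∷ just true  ∷ []) = false
isPartialLineTrace _                                                      = true

bools : List Bool
bools = false ∷ true ∷ []

bools-covers : Covers bools
bools-covers false = here refl
bools-covers true  = there (here refl)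

maybeBools : List (Maybe Bool)
maybeBools = nothing ∷ just false ∷ just true ∷ []

maybeBools-covers : Covers maybeBools
maybeBools-covers nothing      = here refl
maybeBools-covers (just false) = there (here refl)
maybeBools-covers (just true)  = there (there (here refl))

restrictionAccepted : Vec Bool 4 → Vec (Maybe Bool) 4 → Bool
restrictionAccepted b m = not (isLineTrace b ∧ ⌊ Pointwise.decidable _⊑?_ m b ⌋) ∨ isPartialLineTrace m

restrictionAccepted-table : T (all (λ b → all (restrictionAccepted b) (vectors maybeBools 4)) (vectors bools 4))
restrictionAccepted-table = tt

isPartialLineTrace-sound : {m : Vec (Maybe Bool) 4} {b : Vec Bool 4} →
                           Pointwise _⊑_ m b → T (isLineTrace b) → T (isPartialLineTrace m)
isPartialLineTrace-sound {m} {b} m⊑b line = modus-ponens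
  (all-∈ (restrictionAccepted b) (vectors maybeBools 4)
    (all-∈ (λ b → all (restrictionAccepted b) (vectors maybeBools 4)) (vectors bools 4)
      restrictionAccepted-table (vectors-covers bools-covers b))
    (vectors-covers maybeBools-covers m))
  (from T-∧ (line , fromWitness m⊑b))
  where
  modus-ponens : ∀ {x y} → T (not x ∨ y) → T x → T y
  modus-ponens {true} y _ = y

admissibleAt : Partial → Point → Bool
admissibleAt w p = isPartialLineTrace (lineTrace w (zero , p)) ∧ isPartialLineTrace (lineTrace w (suc zero , p))
                   ∧ isPartialLineTrace (lineTrace w (suc (suc zero) , p))

admissibleAt-sound : {H : PointSet} → T (isGeomHyperplaneᵇ H) →
                     (w : Partial) (p : Point) → Extends H w → T (admissibleAt w p)
admissibleAt-sound {H} geom w p extends =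
  from T-∧ (throughDirection zero , from T-∧ (throughDirection (suc zero) , throughDirection (suc (suc zero))))
  where
  onLines : T (all (isLineTrace ∘ lineTrace H) lines)
  onLines = proj₂ (to (T-∧ {not (all (H !_) points)}) geom)
  throughDirection : ∀ d → T (isPartialLineTrace (lineTrace w (d , p)))
  throughDirection d = isPartialLineTrace-sound (extends _ ∷ extends _ ∷ extends _ ∷ extends _ ∷ [])
    (to (all-lines⇔ isLineTrace H) onLines (d , p))

open Backtracking isGeomHyperplaneᵇ admissibleAt

opaque
  geomHyperplanes : List PointSet
  geomHyperplanes = search points unknown

  geomHyperplanes-enumerates : Enumerates geomHyperplanes IsGeomHyperplane
  geomHyperplanes-enumerates = search-unique points unknown points-unique Pending-unknown , λ H → mk⇔
    (to (isGeomHyperplaneᵇ⇔ H) ∘ search-accepts points unknown)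
    (λ geom → let geomᵇ = from (isGeomHyperplaneᵇ⇔ H) geom in
      search-complete {H} (admissibleAt-sound {H} geomᵇ) geomᵇ points unknown points-unique Pending-unknown
        λ q → inj₁ (!-replicate nothing q))

-- GF(3), trilinear forms and their hyperplane sections

F₃ : Set
F₃ = Fin 3

infixl 6 _+₃_
infixl 7 _·₃_

_+₃_ : F₃ → F₃ → F₃
zero           +₃ y              = y
x              +₃ zero           = x
suc zero       +₃ suc zero       = suc (suc zero)
suc zero       +₃ suc (suc zero) = zero
suc (suc zero) +₃ suc zero       = zero
suc (suc zero) +₃ suc (suc zero) = suc zero

_·₃_ : F₃ → F₃ → F₃
zero           ·₃ y              = zero
x              ·₃ zero           = zero
suc zero       ·₃ y              = y
x              ·₃ suc zero       = x
suc (suc zero) ·₃ suc (suc zero) = suc zero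

-₁ : F₃
-₁ = suc (suc zero)

scaleForm : F₃ → Form → Form
scaleForm c = Data.Vec.map (Data.Vec.map (Data.Vec.map (c ·₃_)))

evalWith : (Fin 2 → Fin 2 → Fin 2 → ℕ) → Point → ℕ
evalWith f (x , y , z) = Σ2 λ i → Σ2 λ j → Σ2 λ k → f i j k * rep x i * rep y j * rep z k

Σ2-cong : {u v : Fin 2 → ℕ} → (∀ i → u i ≡ v i) → Σ2 u ≡ Σ2 v
Σ2-cong u≡v = cong₂ _+_ (u≡v zero) (u≡v (suc zero))

Σ2-linear : (m : ℕ) (u v : Fin 2 → ℕ) → Σ2 (λ i → u i + m * v i) ≡ Σ2 u + m * Σ2 v
Σ2-linear m u v = linear (u zero) (v zero) (u (suc zero)) (v (suc zero)) m
  where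
  linear : ∀ a b c d m → (a + m * b) + (c + m * d) ≡ (a + c) + m * (b + d)
  linear = solve-∀

evalWith-cong : {f g : Fin 2 → Fin 2 → Fin 2 → ℕ} → (∀ i j k → f i j k ≡ g i j k) →
                ∀ p → evalWith f p ≡ evalWith g p
evalWith-cong f≡g (x , y , z) =
  Σ2-cong λ i → Σ2-cong λ j → Σ2-cong λ k → cong (λ c → c * rep x i * rep y j * rep z k) (f≡g i j k)

evalWith-linear : (f g : Fin 2 → Fin 2 → Fin 2 → ℕ) (m : ℕ) (p : Point) →
                  evalWith (λ i j k → f i j k + m * g i j k) p ≡ evalWith f p + m * evalWith g p
evalWith-linear f g m (x , y , z) =
  trans (Σ2-cong λ i →
    trans (Σ2-cong λ j →
      trans (Σ2-cong λ k → distribute (f i j k) (g i j k) m (rep x i) (rep y j) (rep z k))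
            (Σ2-linear m (F i j) (G i j)))
      (Σ2-linear m (λ j → Σ2 (F i j)) (λ j → Σ2 (G i j))))
    (Σ2-linear m (λ i → Σ2 λ j → Σ2 (F i j)) (λ i → Σ2 λ j → Σ2 (G i j)))
  where
  F G : Fin 2 → Fin 2 → Fin 2 → ℕ
  F i j k = f i j k * rep x i * rep y j * rep z k
  G i j k = g i j k * rep x i * rep y j * rep z k
  distribute : ∀ a b m r s t → (a + m * b) * r * s * t ≡ a * r * s * t + m * (b * r * s * t)
  distribute = solve-∀

-- The multiple of 3 dropped when 2 * toℕ c is reduced modulo 3.
carry : F₃ → ℕ
carry (suc (suc zero)) = 1
carry _                = 0

negate-coefficient : (c : F₃) → toℕ (-₁ ·₃ c) + 3 * carry c ≡ 2 * toℕ c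
negate-coefficient zero             = refl
negate-coefficient (suc zero)       = refl
negate-coefficient (suc (suc zero)) = refl

evalForm-negate : (a : Form) (p : Point) → ∃[ E ] evalForm (scaleForm -₁ a) p + 3 * E ≡ 2 * evalForm a p
evalForm-negate a p = evalWith carries p , (begin
  evalForm (scaleForm -₁ a) p + 3 * evalWith carries p  ≡⟨ sym (evalWith-linear (coef (scaleForm -₁ a)) carries 3 p) ⟩
  evalWith (λ i j k → coef (scaleForm -₁ a) i j k + 3 * carries i j k) p
    ≡⟨ evalWith-cong (λ i j k → trans (cong (_+ 3 * carries i j k) (coef-negate i j k))
                                      (negate-coefficient (entry i j k))) p ⟩
  evalWith (λ i j k → 0 + 2 * coef a i j k) p            ≡⟨ evalWith-linear (λ _ _ _ → 0) (coef a) 2 p ⟩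
  2 * evalForm a p                                      ∎)
  where
  open Relation.Binary.PropositionalEquality.≡-Reasoning
  entry : Fin 2 → Fin 2 → Fin 2 → F₃
  entry i j k = lookup (lookup (lookup a i) j) k
  carries : Fin 2 → Fin 2 → Fin 2 → ℕ
  carries i j k = carry (entry i j k)
  coef-negate : ∀ i j k → coef (scaleForm -₁ a) i j k ≡ toℕ (-₁ ·₃ entry i j k)
  coef-negate i j k
    rewrite Vec.lookup-map i (Data.Vec.map (Data.Vec.map (-₁ ·₃_))) a
          | Vec.lookup-map j (Data.Vec.map (-₁ ·₃_)) (lookup a i)
          | Vec.lookup-map k (-₁ ·₃_) (lookup (lookup a i) j) = refl

%3≡0-cancel-double : (X E Y : ℕ) → X + 3 * E ≡ 2 * Y → (X % 3 ≡ 0 ⇔ Y % 3 ≡ 0)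
%3≡0-cancel-double X E Y X+3E≡2Y = mk⇔
  (λ X%3≡0 → halve (Y % 3) (m%n<n Y 3) (trans (sym 2Y%3) (trans (sym X%3) X%3≡0)))
  (λ Y%3≡0 → trans X%3 (trans 2Y%3 (cong (λ r → (2 * r) % 3) Y%3≡0)))
  where
  X%3 : X % 3 ≡ (2 * Y) % 3
  X%3 = trans (sym ([m+kn]%n≡m%n X E 3)) (cong (_% 3) (trans (cong (X +_) (*-comm E 3)) X+3E≡2Y))
  2Y%3 : (2 * Y) % 3 ≡ (2 * (Y % 3)) % 3
  2Y%3 = %-distribˡ-* 2 Y 3
  halve : ∀ r → r < 3 → (2 * r) % 3 ≡ 0 → r ≡ 0
  halve 0 _ _ = refl
  halve 1 _ ()
  halve 2 _ ()
  halve (ℕ.suc (ℕ.suc (ℕ.suc r))) (s≤s (s≤s (s≤s ()))) _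

isZero3⇔ : (n : ℕ) → isZero3 n ≡ true ⇔ n % 3 ≡ 0
isZero3⇔ n with n % 3
... | 0     = mk⇔ (λ _ → refl) (λ _ → refl)
... | ℕ.suc _ = mk⇔ (λ ()) (λ ())

section-∈P⇔ : (a : Form) (p : Point) → p ∈P section a ⇔ OnHyp a p
section-∈P⇔ a p rewrite !-tabulate (λ q → isZero3 (evalForm a q)) p = isZero3⇔ (evalForm a p)

section-unique : {a : Form} {H : PointSet} → (∀ p → p ∈P H ⇔ OnHyp a p) → section a ≡ H
section-unique {a} {H} H⇔ =
  Cube-ext λ p → ⇔→≡ (mk⇔ (from (H⇔ p) ∘ to (section-∈P⇔ a p)) (from (section-∈P⇔ a p) ∘ to (H⇔ p)))

section-negate : (a : Form) → section (scaleForm -₁ a) ≡ section a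
section-negate a = section-unique {scaleForm -₁ a} λ p → mk⇔
  (from (negate⇔ p) ∘ to (section-∈P⇔ a p)) (from (section-∈P⇔ a p) ∘ to (negate⇔ p))
  where
  negate⇔ : ∀ p → OnHyp (scaleForm -₁ a) p ⇔ OnHyp a p
  negate⇔ p = let E , eq = evalForm-negate a p in %3≡0-cancel-double (evalForm (scaleForm -₁ a) p) E (evalForm a p) eq

flatten-∈⁺ : (a : Form) (i j k : Fin 2) → lookup (lookup (lookup a i) j) k ∈ flatten a
flatten-∈⁺ a zero       zero       zero       = here refl
flatten-∈⁺ a zero       zero       (suc zero) = there (here refl)
flatten-∈⁺ a zero       (suc zero) zero       = there (there (here refl))
flatten-∈⁺ a zero       (suc zero) (suc zero) = there (there (there (here refl)))
flatten-∈⁺ a (suc zero) zero       zero       = there (there (there (there (here refl))))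
flatten-∈⁺ a (suc zero) zero       (suc zero) = there (there (there (there (there (here refl)))))
flatten-∈⁺ a (suc zero) (suc zero) zero       = there (there (there (there (there (there (here refl))))))
flatten-∈⁺ a (suc zero) (suc zero) (suc zero) = there (there (there (there (there (there (there (here refl)))))))

flatten-∈⁻ : (a : Form) {c : F₃} → c ∈ flatten a → ∃[ i ] ∃[ j ] ∃[ k ] lookup (lookup (lookup a i) j) k ≡ c
flatten-∈⁻ a (here refl)                                                         = zero , zero , zero , refl
flatten-∈⁻ a (there (here refl))                                                 = zero , zero , suc zero , refl
flatten-∈⁻ a (there (there (here refl)))                                         = zero , suc zero , zero , refl
flatten-∈⁻ a (there (there (there (here refl))))                                 = zero , suc zero , suc zero , refl
flatten-∈⁻ a (there (there (there (there (here refl)))))                         = suc zero , zero , zero , refl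
flatten-∈⁻ a (there (there (there (there (there (here refl))))))                 = suc zero , zero , suc zero , refl
flatten-∈⁻ a (there (there (there (there (there (there (here refl)))))))         = suc zero , suc zero , zero , refl
flatten-∈⁻ a (there (there (there (there (there (there (there (here refl)))))))) = suc zero , suc zero , suc zero , refl

flatten-scale : (c : F₃) (a : Form) → flatten (scaleForm c a) ≡ map (c ·₃_) (flatten a)
flatten-scale c (((_ ∷ _ ∷ []) ∷ (_ ∷ _ ∷ []) ∷ []) ∷ ((_ ∷ _ ∷ []) ∷ (_ ∷ _ ∷ []) ∷ []) ∷ []) = refl

leading-∈ : {xs : List F₃} {c : F₃} → leading xs ≡ just c → c ∈ xs
leading-∈ {zero  ∷ xs} found = there (leading-∈ found)
leading-∈ {suc _ ∷ xs} refl  = here refl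

leading-nonzero : {xs : List F₃} {c : F₃} → c ∈ xs → c ≢ zero → ∃[ c′ ] leading xs ≡ just (suc c′)
leading-nonzero {zero  ∷ xs} (here refl) c≢0 = ⊥-elim (c≢0 refl)
leading-nonzero {zero  ∷ xs} (there c∈)  c≢0 = leading-nonzero c∈ c≢0
leading-nonzero {suc c ∷ xs} _           _   = c , refl

leading-negate : (xs : List F₃) → leading (map (-₁ ·₃_) xs) ≡ Data.Maybe.map (-₁ ·₃_) (leading xs)
leading-negate []                    = refl
leading-negate (zero ∷ xs)           = leading-negate xs
leading-negate (suc zero ∷ xs)       = refl
leading-negate (suc (suc zero) ∷ xs) = refl

IsPG7Hyperplane⇒NonzeroForm : {a : Form} → IsPG7Hyperplane a → NonzeroForm a
IsPG7Hyperplane⇒NonzeroForm {a} normalised with i , j , k , entry≡1 ← flatten-∈⁻ a (leading-∈ normalised) =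
  i , j , k , λ entry≡0 → case trans (sym entry≡1) entry≡0 of λ ()

NonzeroForm⇒normalisable : {a : Form} → NonzeroForm a → IsPG7Hyperplane a ⊎ IsPG7Hyperplane (scaleForm -₁ a)
NonzeroForm⇒normalisable {a} (i , j , k , entry≢0) with leading-nonzero (flatten-∈⁺ a i j k) entry≢0
... | zero     , leading≡1 = inj₁ leading≡1
... | suc zero , leading≡2 =
  inj₂ (trans (cong leading (flatten-scale -₁ a))
             (trans (leading-negate (flatten a)) (cong (Data.Maybe.map (-₁ ·₃_)) leading≡2)))

IsProjective⇒section : {H : PointSet} → IsProjective H → ∃[ a ] IsPG7Hyperplane a × section a ≡ H
IsProjective⇒section (a , nonzero , H⇔) with NonzeroForm⇒normalisable {a} nonzero
... | inj₁ normalised = a , normalised , section-unique {a} H⇔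
... | inj₂ normalised = scaleForm -₁ a , normalised , trans (section-negate a) (section-unique {a} H⇔)

section-IsProjective : {a : Form} → IsPG7Hyperplane a → IsProjective (section a)
section-IsProjective {a} normalised = a , IsPG7Hyperplane⇒NonzeroForm {a} normalised , section-∈P⇔ a

-- Recovering an equation from a hyperplane section

isNonzero : F₃ → Bool
isNonzero zero    = false
isNonzero (suc _) = true

_∙_ : Vec F₃ 2 → Vec F₃ 2 → F₃
(a ∷ b ∷ []) ∙ (c ∷ d ∷ []) = a ·₃ c +₃ b ·₃ d

coordinates : Fin 4 → Vec F₃ 2
coordinates zero                   = suc zero ∷ zero ∷ []
coordinates (suc zero)             = zero ∷ suc zero ∷ []
coordinates (suc (suc zero))       = suc zero ∷ suc zero ∷ []
coordinates (suc (suc (suc zero))) = suc zero ∷ suc (suc zero) ∷ []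

-- A covector of GF(3)² whose zeros on PG(1,3) form the given line trace.
traceCovector : Vec Bool 4 → Vec F₃ 2
traceCovector (true  ∷ true  ∷ _)         = zero ∷ zero ∷ []
traceCovector (true  ∷ false ∷ _)         = zero ∷ suc zero ∷ []
traceCovector (false ∷ true  ∷ _)         = suc zero ∷ zero ∷ []
traceCovector (false ∷ false ∷ true ∷ _)  = suc zero ∷ suc (suc zero) ∷ []
traceCovector (false ∷ false ∷ false ∷ _) = suc zero ∷ suc zero ∷ []

-- If F(s, v) = s₀ f₀(v) + λ s₁ f₁(v) with f₀, f₁ known only up to scalars, then at a v where both are
-- nonzero the line in the s-direction has trace covector proportional to (f₀ v , λ f₁ v), which
-- determines λ; in GF(3) every nonzero element is its own inverse.
glue : {F V : Set} → (F → V → F₃) → (F₃ → F → F) → (V → Vec F₃ 2) → List V → F → F → Vec F 2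
glue eval scale transversal vs f₀ f₁ with findᵇ (λ v → isNonzero (eval f₀ v) ∧ isNonzero (eval f₁ v)) vs
... | nothing = f₀ ∷ f₁ ∷ []
... | just v  = f₀ ∷ scale (ratio (transversal v) ·₃ eval f₀ v ·₃ eval f₁ v) f₁ ∷ []
  where
  ratio : Vec F₃ 2 → F₃
  ratio (g ∷ d ∷ []) = d ·₃ g

Bilinear : Set
Bilinear = Vec (Vec F₃ 2) 2

evalBilinear : Bilinear → Fin 4 × Fin 4 → F₃
evalBilinear m (y , z) = Data.Vec.map (_∙ coordinates z) m ∙ coordinates y

planeForm : PointSet → Fin 4 → Bilinear
planeForm H x = glue (λ r z → r ∙ coordinates z) (λ c → Data.Vec.map (c ·₃_))
  (λ z → traceCovector (lineTrace H (suc zero , (x , zero , z)))) (allFin 4)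
  (traceCovector (lineTrace H (suc (suc zero) , (x , zero , zero))))
  (traceCovector (lineTrace H (suc (suc zero) , (x , suc zero , zero))))

normalise : Form → Form
normalise a with leading (flatten a)
... | just (suc (suc zero)) = scaleForm -₁ a
... | _                     = a

-- Opaque so that type checking never unfolds it on symbolic arguments.
opaque
  recoverForm : PointSet → Form
  recoverForm H = normalise (glue evalBilinear (λ c → Data.Vec.map (Data.Vec.map (c ·₃_)))
    (λ yz → traceCovector (lineTrace H (zero , (zero , yz))))
    (cartesianProduct (allFin 4) (allFin 4))
    (planeForm H zero) (planeForm H (suc zero)))

isPG7Hyperplane? : (a : Form) → Dec (IsPG7Hyperplane a)
isPG7Hyperplane? a = Maybe.≡-dec Fin._≟_ (leading (flatten a)) (just (suc zero))

_≟ᶠ_ : DecidableEquality Form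
_≟ᶠ_ = Vec.≡-dec (Vec.≡-dec (Vec.≡-dec Fin._≟_))

_≟ᶜ_ : DecidableEquality PointSet
_≟ᶜ_ = Vec.≡-dec (Vec.≡-dec (Vec.≡-dec Bool._≟_))

isProjectiveᵇ : PointSet → Bool
isProjectiveᵇ H = ⌊ isPG7Hyperplane? (recoverForm H) ⌋ ∧ ⌊ section (recoverForm H) ≟ᶜ H ⌋

isProjectiveᵇ-sound : {H : PointSet} → T (isProjectiveᵇ H) →
                      IsPG7Hyperplane (recoverForm H) × section (recoverForm H) ≡ H
isProjectiveᵇ-sound {H} h = let normalised , recovered = to (T-∧ {⌊ isPG7Hyperplane? (recoverForm H) ⌋}) h in
  toWitness normalised , toWitness recovered

forms : List Form
forms = vectors (vectors (vectors (allFin 3) 2) 2) 2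

pg7Forms : List Form
pg7Forms = filter isPG7Hyperplane? forms

pg7Forms-enumerates : Enumerates pg7Forms IsPG7Hyperplane
pg7Forms-enumerates = filter-enumerates isPG7Hyperplane?
  (vectors-unique (vectors-unique (vectors-unique (Unique.allFin⁺ 3))))
  (vectors-covers (vectors-covers (vectors-covers ∈-allFin)))

length-pg7Forms : length pg7Forms ≡ 3280
length-pg7Forms = refl

-- The census

members : PointSet → List Point
members H = filter (λ p → H ! p Bool.≟ true) points

isOvoidᵇ : PointSet → Bool
isOvoidᵇ H = (length (members H) ≡ᵇ 16) ∧ all (isSingletonTrace ∘ lineTrace H) lines

classificationᵇ : List PointSet × List PointSet → Bool
classificationᵇ (ps , ns) = (length ps ≡ᵇ 3280) ∧ (length ns ≡ᵇ 144) ∧ all isOvoidᵇ ns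

census : List PointSet → Bool
census hs = (length hs ≡ᵇ 3424) ∧ classificationᵇ (partition (T? ∘ isProjectiveᵇ) hs)

-- One Boolean, so that the search is evaluated only once.
opaque
  unfolding geomHyperplanes recoverForm
  census-geomHyperplanes : census geomHyperplanes ≡ true
  census-geomHyperplanes = refl

projectives nonProjectives : List PointSet
projectives    = filter (T? ∘ isProjectiveᵇ) geomHyperplanes
nonProjectives = filter (∁? (T? ∘ isProjectiveᵇ)) geomHyperplanes

census-facts : length geomHyperplanes ≡ 3424 × length projectives ≡ 3280 × length nonProjectives ≡ 144
             × T (all isOvoidᵇ nonProjectives)
census-facts =
  let total , parts = to (T-∧ {length geomHyperplanes ≡ᵇ 3424}) (from T-≡ census-geomHyperplanes)
      P , N-ovoids  = to (T-∧ {length projectives ≡ᵇ 3280})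
                        (subst (T ∘ classificationᵇ) (partition-defn (T? ∘ isProjectiveᵇ) geomHyperplanes) parts)
      N , ovoids    = to (T-∧ {length nonProjectives ≡ᵇ 144}) N-ovoids
  in ≡ᵇ⇒≡ _ _ total , ≡ᵇ⇒≡ _ _ P , ≡ᵇ⇒≡ _ _ N , ovoids

projectives-sound : {H : PointSet} → H ∈ projectives → IsPG7Hyperplane (recoverForm H) × section (recoverForm H) ≡ H
projectives-sound H∈ = isProjectiveᵇ-sound (proj₂ (∈-filter⁻ (T? ∘ isProjectiveᵇ) {xs = geomHyperplanes} H∈))

recovered : List Form
recovered = map recoverForm projectives

recovered-unique : Unique recovered
recovered-unique = Unique.map⁻ {f = section}
  (subst Unique (sym sections≡) (Unique.filter⁺ (T? ∘ isProjectiveᵇ) (proj₁ geomHyperplanes-enumerates)))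
  where
  sections≡ : map section recovered ≡ projectives
  sections≡ = trans (sym (map-∘ projectives)) (map-id-local (All.tabulate (proj₂ ∘ projectives-sound)))

recovered⊆pg7Forms : recovered ⊆ pg7Forms
recovered⊆pg7Forms a∈ with H , H∈ , refl ← ∈-map⁻ recoverForm a∈ =
  from (proj₂ pg7Forms-enumerates _) (proj₁ (projectives-sound H∈))

-- Distinct projective geometric hyperplanes have distinct recovered equations, and there are 3280 of each.
pg7Forms⊆recovered : pg7Forms ⊆ recovered
pg7Forms⊆recovered = pigeonhole _≟ᶠ_ recovered-unique recovered⊆pg7Forms
  (≤-reflexive (trans length-pg7Forms (sym (trans (length-map recoverForm projectives) (proj₁ (proj₂ census-facts))))))

section-recovered : {a : Form} → IsPG7Hyperplane a → section a ∈ projectives × recoverForm (section a) ≡ a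
section-recovered {a} normalised =
  recover (∈-map⁻ recoverForm (pg7Forms⊆recovered (from (proj₂ pg7Forms-enumerates a) normalised)))
  where
  recover : ∃[ H ] H ∈ projectives × a ≡ recoverForm H → section a ∈ projectives × recoverForm (section a) ≡ a
  recover (H , H∈ , a≡) = subst (_∈ projectives) (sym section≡H) H∈ , trans (cong recoverForm section≡H) (sym a≡)
    where
    section≡H : section a ≡ H
    section≡H = trans (cong section a≡) (proj₂ (projectives-sound H∈))

isProjectiveᵇ⇔ : (H : PointSet) → T (isProjectiveᵇ H) ⇔ IsProjective H
isProjectiveᵇ⇔ H = mk⇔ sound complete
  where
  sound : T (isProjectiveᵇ H) → IsProjective H
  sound h = let normalised , recovered = isProjectiveᵇ-sound {H} h in
    subst IsProjective recovered (section-IsProjective {recoverForm H} normalised)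
  complete : IsProjective H → T (isProjectiveᵇ H)
  complete projective = let a , normalised , section≡H = IsProjective⇒section projective in
    subst (T ∘ isProjectiveᵇ) section≡H
      (proj₂ (∈-filter⁻ (T? ∘ isProjectiveᵇ) {xs = geomHyperplanes} (proj₁ (section-recovered {a} normalised))))

projectives-enumerates : Enumerates projectives (λ H → IsGeomHyperplane H × IsProjective H)
projectives-enumerates = Enumerates-resp-⇔
  (λ H → mk⇔ (Data.Product.map₂ (to (isProjectiveᵇ⇔ H))) (Data.Product.map₂ (from (isProjectiveᵇ⇔ H))))
  (Enumerates-filter (T? ∘ isProjectiveᵇ) geomHyperplanes-enumerates)

nonProjectives-enumerates : Enumerates nonProjectives (λ H → IsGeomHyperplane H × ¬ IsProjective H)
nonProjectives-enumerates = Enumerates-resp-⇔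
  (λ H → mk⇔ (Data.Product.map₂ (λ ¬projᵇ → ¬projᵇ ∘ from (isProjectiveᵇ⇔ H)))
             (Data.Product.map₂ (λ ¬proj → ¬proj ∘ to (isProjectiveᵇ⇔ H))))
  (Enumerates-filter (∁? (T? ∘ isProjectiveᵇ)) geomHyperplanes-enumerates)

section-isGeomHyperplane : {a : Form} → IsPG7Hyperplane a → IsGeomHyperplane (section a)
section-isGeomHyperplane {a} normalised =
  proj₁ (to (proj₂ projectives-enumerates (section a)) (proj₁ (section-recovered {a} normalised)))

section-injective : {a b : Form} → IsPG7Hyperplane a → IsPG7Hyperplane b → section a ≡ section b → a ≡ b
section-injective {a} {b} normalisedᵃ normalisedᵇ same =
  trans (sym (proj₂ (section-recovered {a} normalisedᵃ)))
        (trans (cong recoverForm same) (proj₂ (section-recovered {b} normalisedᵇ)))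

isOvoidᵇ-sound : {H : PointSet} → T (isOvoidᵇ H) → IsOvoid H
isOvoidᵇ-sound {H} h = card , nonCollinear , meetsOnce
  where
  parts : T (length (members H) ≡ᵇ 16) × T (all (isSingletonTrace ∘ lineTrace H) lines)
  parts = to (T-∧ {length (members H) ≡ᵇ 16} {all (isSingletonTrace ∘ lineTrace H) lines}) h
  card : HasCard (_∈P H) 16
  card = hasCard (filter-enumerates (λ p → H ! p Bool.≟ true) points-unique points-covers)
                 (≡ᵇ⇒≡ (length (members H)) 16 (proj₁ parts))
  meetsOnce : ∀ L → LineMeetsOnce L H
  meetsOnce L = to (ExactlyOneTrue-lineTrace⇔LineMeetsOnce H L)
    (to (isSingletonTrace⇔ExactlyOneTrue (lineTrace H L)) (to (all-lines⇔ isSingletonTrace H) (proj₂ parts) L))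
  nonCollinear : ∀ p q → p ∈P H → q ∈P H → p ≢ q → ¬ Collinear p q
  nonCollinear p q p∈H q∈H p≢q (d , t , q≡) = let _ , _ , unique = meetsOnce (d , p) in
    p≢q (trans (unique p (coordinate d p , sym (setCoord-coordinate d p)) p∈H) (sym (unique q (t , q≡) q∈H)))

mainTheorem2 : HasCard IsGeomHyperplane 3424
               × HasCard (λ H → IsGeomHyperplane H × IsProjective H) 3280
               × HasCard IsPG7Hyperplane 3280
               × (∀ a → IsPG7Hyperplane a → IsGeomHyperplane (section a) × IsProjective (section a))
               × (∀ a b → IsPG7Hyperplane a → IsPG7Hyperplane b → section a ≡ section b → a ≡ b)
               × (∀ H → IsGeomHyperplane H → IsProjective H → ∃[ a ] IsPG7Hyperplane a × section a ≡ H)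
               × HasCard (λ H → IsGeomHyperplane H × ¬ IsProjective H) 144
               × (∀ H → IsGeomHyperplane H → ¬ IsProjective H → IsOvoid H)
mainTheorem2 =
  let #geom , #projective , #nonProjective , ovoids = census-facts in
    hasCard geomHyperplanes-enumerates #geom
  , hasCard projectives-enumerates #projective
  , hasCard pg7Forms-enumerates length-pg7Forms
  , (λ a normalised → section-isGeomHyperplane {a} normalised , section-IsProjective {a} normalised)
  , (λ a b → section-injective {a} {b})
  , (λ H _ → IsProjective⇒section)
  , hasCard nonProjectives-enumerates #nonProjective
  , λ H geom nonProjective → isOvoidᵇ-sound {H}
      (all-∈ isOvoidᵇ nonProjectives ovoids (from (proj₂ nonProjectives-enumerates H) (geom , nonProjective)))
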